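{- Let $\mathcal{C}$ be a regular category and let $\mathcal{S}$ be the class of regular epimorphisms in $\mathcal{C}$. Then $\mathsf{Span}^{\mathcal{S}}(\mathcal{C}) \cong \mathsf{Rel}(\mathcal{C})$ (as cartesian bicategories, i.e. poset-enriched symmetric monoidal categories with the chosen comonoids/monoids).
   Context: A category $\mathcal{C}$ is regular if it has finite limits, coequalisers of kernel pairs, and regular epimorphisms (epis that are coequalisers of some pair of morphisms) are stable under pullback; every morphism then factors as a regular epi followed by a mono. $\mathsf{Rel}(\mathcal{C})$ has the objects of $\mathcal{C}$; a morphism $X \to Y$ is a jointly mono span $X \xleftarrow{f} A \xrightarrow{g} Y$ (i.e. $\langle f,g\rangle \colon A \to X\times Y$ is mono); the image of an arbitrary span is obtained from the regular epi–mono factorisation of $\langle f,g\rangle$; composition is span composition via pullback followed by taking the image; identities are $X \xleftarrow{\mathrm{id}} X \xrightarrow{\mathrm{id}} X$; the monoidal product is induced by the product of $\mathcal{C}$; and $(X\leftarrow A\to Y) \le (X\leftarrow B\to Y)$ iff there is $\alpha\colon A\to B$ commuting with both legs. A system of covers on a category with finite products and weak pullbacks is a class $\mathcal{S}$ of morphisms containing identities and closed under composition, products and weak pullback, such that $f ; \pi \in \mathcal{S}$ implies $\pi\in\mathcal{S}$ (here $;$ is diagrammatic composition: first $f$, then $\pi$). In a regular category the regular epis form a system of covers. For such $\mathcal{S}$, $\mathsf{Span}^{\mathcal{S}}(\mathcal{C})$ has the objects of $\mathcal{C}$, and a morphism $X\to Y$ is an equivalence class of spans $X\leftarrow A\to Y$,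 where $(X\leftarrow A\to Y)\le(X\leftarrow B\to Y)$ iff there exist an object $A'$, a cover $\pi\colon A'\to A$ in $\mathcal{S}$ and a morphism $\alpha\colon A'\to B$ such that the legs of the first span precomposed with $\pi$ equal the legs of the second span precomposed with $\alpha$; two spans are identified iff $s_1\le s_2\le s_1$. Composition is by weak pullback in $\mathcal{C}$, identities are identity spans, and the monoidal product and unit come from the finite products and terminal object of $\mathcal{C}$. -}

module Defs where

open import Level using (Level; _⊔_; Lift) renaming (suc to lsuc)
open import Relation.Binary.PropositionalEquality using (_≡_; refl; sym; trans; cong)
open import Data.Product using (Σ; Σ-syntax; _×_; _,_; proj₁; proj₂)

record Category (o ℓ : Level) : Set (lsuc (o ⊔ ℓ)) where
  infixr 9 _∘_
  infix 4 _⇒_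
  field
    Obj : Set o
    _⇒_ : Obj → Obj → Set ℓ
    id  : ∀ {A} → A ⇒ A
    _∘_ : ∀ {A B C} → B ⇒ C → A ⇒ B → A ⇒ C
    identityˡ : ∀ {A B} {f : A ⇒ B} → id ∘ f ≡ f
    identityʳ : ∀ {A B} {f : A ⇒ B} → f ∘ id ≡ f
    assoc : ∀ {A B C D} {f : A ⇒ B} {g : B ⇒ C} {h : C ⇒ D} →
            (h ∘ g) ∘ f ≡ h ∘ (g ∘ f)

module Notions {o ℓ : Level} (𝒞 : Category o ℓ) where
  open Category 𝒞

  Mono : ∀ {A B} → A ⇒ B → Set (o ⊔ ℓ)
  Mono {A} f = ∀ {Z} (h k : Z ⇒ A) → f ∘ h ≡ f ∘ k → h ≡ k

  JointlyMono : ∀ {A X Y} → A ⇒ X → A ⇒ Y → Set (o ⊔ ℓ)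
  JointlyMono {A} f g = ∀ {Z} (h k : Z ⇒ A) → f ∘ h ≡ f ∘ k → g ∘ h ≡ g ∘ k → h ≡ k

  record IsTerminal (T : Obj) : Set (o ⊔ ℓ) where
    field
      !        : ∀ {A} → A ⇒ T
      !-unique : ∀ {A} (h : A ⇒ T) → h ≡ !

  record IsProduct {A B P : Obj} (p₁ : P ⇒ A) (p₂ : P ⇒ B) : Set (o ⊔ ℓ) where
    field
      ⟨_,_⟩  : ∀ {Z} → Z ⇒ A → Z ⇒ B → Z ⇒ P
      β₁     : ∀ {Z} {h : Z ⇒ A} {k : Z ⇒ B} → p₁ ∘ ⟨ h , k ⟩ ≡ h
      β₂     : ∀ {Z} {h : Z ⇒ A} {k : Z ⇒ B} → p₂ ∘ ⟨ h , k ⟩ ≡ k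
      unique : ∀ {Z} {h : Z ⇒ A} {k : Z ⇒ B} (u : Z ⇒ P) →
               p₁ ∘ u ≡ h → p₂ ∘ u ≡ k → u ≡ ⟨ h , k ⟩

  record IsPullback {A B X P : Obj} (f : A ⇒ X) (g : B ⇒ X)
                    (p₁ : P ⇒ A) (p₂ : P ⇒ B) : Set (o ⊔ ℓ) where
    field
      commute   : f ∘ p₁ ≡ g ∘ p₂
      universal : ∀ {Z} (h : Z ⇒ A) (k : Z ⇒ B) → f ∘ h ≡ g ∘ k → Z ⇒ P
      β₁        : ∀ {Z} {h : Z ⇒ A} {k : Z ⇒ B} {eq : f ∘ h ≡ g ∘ k} →
                  p₁ ∘ universal h k eq ≡ h
      β₂        : ∀ {Z} {h : Z ⇒ A} {k : Z ⇒ B} {eq : f ∘ h ≡ g ∘ k} →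
                  p₂ ∘ universal h k eq ≡ k
      unique    : ∀ {Z} {h : Z ⇒ A} {k : Z ⇒ B} {eq : f ∘ h ≡ g ∘ k} (u : Z ⇒ P) →
                  p₁ ∘ u ≡ h → p₂ ∘ u ≡ k → u ≡ universal h k eq

  record Pullback {A B X : Obj} (f : A ⇒ X) (g : B ⇒ X) : Set (o ⊔ ℓ) where
    field
      P          : Obj
      p₁         : P ⇒ A
      p₂         : P ⇒ B
      isPullback : IsPullback f g p₁ p₂

  record IsCoequalizer {A B Q : Obj} (f g : A ⇒ B) (q : B ⇒ Q) : Set (o ⊔ ℓ) where
    field
      equality   : q ∘ f ≡ q ∘ g
      coequalize : ∀ {Z} (h : B ⇒ Z) → h ∘ f ≡ h ∘ g → Q ⇒ Z
      universal  : ∀ {Z} {h : B ⇒ Z} {eq : h ∘ f ≡ h ∘ g} → coequalize h eq ∘ q ≡ h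
      unique     : ∀ {Z} {h : B ⇒ Z} {eq : h ∘ f ≡ h ∘ g} (u : Q ⇒ Z) →
                   u ∘ q ≡ h → u ≡ coequalize h eq

  record Coequalizer {A B : Obj} (f g : A ⇒ B) : Set (o ⊔ ℓ) where
    field
      Q             : Obj
      q             : B ⇒ Q
      isCoequalizer : IsCoequalizer f g q

  RegularEpi : ∀ {B Q} → B ⇒ Q → Set (o ⊔ ℓ)
  RegularEpi {B} e = Σ[ A ∈ Obj ] Σ[ f ∈ A ⇒ B ] Σ[ g ∈ A ⇒ B ] IsCoequalizer f g e

  record Factorisation {A B : Obj} (h : A ⇒ B) : Set (o ⊔ ℓ) where
    field
      Im      : Obj
      e       : A ⇒ Im
      m       : Im ⇒ B
      e-regEpi : RegularEpi e
      m-mono  : Mono m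
      factors : m ∘ e ≡ h

record RegularCategory (o ℓ : Level) : Set (lsuc (o ⊔ ℓ)) where
  field
    cat : Category o ℓ
  open Category cat
  open Notions cat
  infixr 7 _×ₒ_
  field
    ⊤        : Obj
    terminal : IsTerminal ⊤
    _×ₒ_     : Obj → Obj → Obj
    π₁       : ∀ {A B} → A ×ₒ B ⇒ A
    π₂       : ∀ {A B} → A ×ₒ B ⇒ B
    product  : ∀ {A B} → IsProduct (π₁ {A} {B}) (π₂ {A} {B})
    pullback : ∀ {A B X} (f : A ⇒ X) (g : B ⇒ X) → Pullback f g
    kernelPairCoeq : ∀ {A B} (f : A ⇒ B) →
      Coequalizer (Pullback.p₁ (pullback f f)) (Pullback.p₂ (pullback f f))
    regEpi-stable : ∀ {A B X P} {e : A ⇒ X} {f : B ⇒ X} {p₁ : P ⇒ A} {p₂ : P ⇒ B} →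
      IsPullback e f p₁ p₂ → RegularEpi e → RegularEpi p₂
    -- the (derivable) regular epi / mono factorisation, as chosen data
    factorise : ∀ {A B} (h : A ⇒ B) → Factorisation h

module Structures {o ℓ : Level} (R : RegularCategory o ℓ) where
  open RegularCategory R
  open Category cat
  open Notions cat
  open IsTerminal terminal public using (!)
  open module Prod {A} {B} = IsProduct (product {A} {B}) public using (⟨_,_⟩)

  infixr 7 _⁂_
  _⁂_ : ∀ {A B C D} → A ⇒ B → C ⇒ D → A ×ₒ C ⇒ B ×ₒ D
  f ⁂ g = ⟨ f ∘ π₁ , g ∘ π₂ ⟩

  swap : ∀ {X Y} → X ×ₒ Y ⇒ Y ×ₒ X
  swap = ⟨ π₂ , π₁ ⟩
  assocʳ : ∀ {X Y Z} → (X ×ₒ Y) ×ₒ Z ⇒ X ×ₒ (Y ×ₒ Z)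
  assocʳ = ⟨ π₁ ∘ π₁ , ⟨ π₂ ∘ π₁ , π₂ ⟩ ⟩
  unitorˡ : ∀ {X} → ⊤ ×ₒ X ⇒ X
  unitorˡ = π₂
  unitorʳ : ∀ {X} → X ×ₒ ⊤ ⇒ X
  unitorʳ = π₁
  diag : ∀ {X} → X ⇒ X ×ₒ X
  diag = ⟨ id , id ⟩

  record CartesianBicategoryData (c : Level) : Set (o ⊔ ℓ ⊔ lsuc c) where
    infix 4 _≤_
    infixr 9 _⨾_
    infixr 7 _⊗_
    field
      Hom  : Obj → Obj → Set c
      _≤_  : ∀ {X Y} → Hom X Y → Hom X Y → Set c
      idₕ  : ∀ {X} → Hom X X
      _⨾_  : ∀ {X Y Z} → Hom X Y → Hom Y Z → Hom X Z
      _⊗_  : ∀ {X Y X' Y'} → Hom X Y → Hom X' Y' → Hom (X ×ₒ X') (Y ×ₒ Y')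
      σ    : ∀ {X Y} → Hom (X ×ₒ Y) (Y ×ₒ X)
      α    : ∀ {X Y Z} → Hom ((X ×ₒ Y) ×ₒ Z) (X ×ₒ (Y ×ₒ Z))
      λₕ   : ∀ {X} → Hom (⊤ ×ₒ X) X
      ρₕ   : ∀ {X} → Hom (X ×ₒ ⊤) X
      copy      : ∀ {X} → Hom X (X ×ₒ X)
      discard   : ∀ {X} → Hom X ⊤
      cocopy    : ∀ {X} → Hom (X ×ₒ X) X
      codiscard : ∀ {X} → Hom ⊤ X

    _≃_ : ∀ {X Y} → Hom X Y → Hom X Y → Set c
    s ≃ t = (s ≤ t) × (t ≤ s)

  record CBIso {c d : Level} (D : CartesianBicategoryData c) (E : CartesianBicategoryData d)
         : Set (o ⊔ c ⊔ d) where
    private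
      module D = CartesianBicategoryData D
      module E = CartesianBicategoryData E
    field
      F : ∀ {X Y} → D.Hom X Y → E.Hom X Y
      G : ∀ {X Y} → E.Hom X Y → D.Hom X Y
      F-monotone : ∀ {X Y} {s t : D.Hom X Y} → s D.≤ t → F s E.≤ F t
      G-monotone : ∀ {X Y} {s t : E.Hom X Y} → s E.≤ t → G s D.≤ G t
      GF≃id : ∀ {X Y} (s : D.Hom X Y) → G (F s) D.≃ s
      FG≃id : ∀ {X Y} (r : E.Hom X Y) → F (G r) E.≃ r
      F-id  : ∀ {X} → F (D.idₕ {X}) E.≃ E.idₕ
      F-⨾   : ∀ {X Y Z} (s : D.Hom X Y) (t : D.Hom Y Z) → F (s D.⨾ t) E.≃ (F s E.⨾ F t)
      F-⊗   : ∀ {X Y X' Y'} (s : D.Hom X Y) (t : D.Hom X' Y') →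
              F (s D.⊗ t) E.≃ (F s E.⊗ F t)
      F-σ   : ∀ {X Y} → F (D.σ {X} {Y}) E.≃ E.σ
      F-α   : ∀ {X Y Z} → F (D.α {X} {Y} {Z}) E.≃ E.α
      F-λ   : ∀ {X} → F (D.λₕ {X}) E.≃ E.λₕ
      F-ρ   : ∀ {X} → F (D.ρₕ {X}) E.≃ E.ρₕ
      F-copy      : ∀ {X} → F (D.copy {X}) E.≃ E.copy
      F-discard   : ∀ {X} → F (D.discard {X}) E.≃ E.discard
      F-cocopy    : ∀ {X} → F (D.cocopy {X}) E.≃ E.cocopy
      F-codiscard : ∀ {X} → F (D.codiscard {X}) E.≃ E.codiscard

  record Span (X Y : Obj) : Set (o ⊔ ℓ) where
    constructor span
    field
      apex  : Obj
      left  : apex ⇒ X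
      right : apex ⇒ Y
  open Span public

  idSpan : ∀ {X} → Span X X
  idSpan {X} = span X id id

  graph : ∀ {X Y} → X ⇒ Y → Span X Y
  graph {X} f = span X id f

  cograph : ∀ {X Y} → X ⇒ Y → Span Y X
  cograph {X} f = span X f id

  _⨾ₛ_ : ∀ {X Y Z} → Span X Y → Span Y Z → Span X Z
  s ⨾ₛ t = span P (left s ∘ p₁) (right t ∘ p₂)
    where open Pullback (pullback (right s) (left t))

  _⊗ₛ_ : ∀ {X Y X' Y'} → Span X Y → Span X' Y' → Span (X ×ₒ X') (Y ×ₒ Y')
  s ⊗ₛ t = span (apex s ×ₒ apex t) (left s ⁂ left t) (right s ⁂ right t)

  _≤[_]_ : ∀ {X Y} → Span X Y → (∀ {A B} → A ⇒ B → Set (o ⊔ ℓ)) → Span X Y → Set (o ⊔ ℓ)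
  s ≤[ S ] t = Σ[ A' ∈ Obj ] Σ[ π ∈ A' ⇒ apex s ] Σ[ a ∈ A' ⇒ apex t ]
               (S π × (left s ∘ π ≡ left t ∘ a) × (right s ∘ π ≡ right t ∘ a))

  SpanS : (∀ {A B} → A ⇒ B → Set (o ⊔ ℓ)) → CartesianBicategoryData (o ⊔ ℓ)
  SpanS S = record
    { Hom = Span
    ; _≤_ = λ s t → s ≤[ S ] t
    ; idₕ = idSpan
    ; _⨾_ = _⨾ₛ_
    ; _⊗_ = _⊗ₛ_
    ; σ = graph swap
    ; α = graph assocʳ
    ; λₕ = graph unitorˡ
    ; ρₕ = graph unitorʳ
    ; copy = graph diag
    ; discard = graph !
    ; cocopy = cograph diag
    ; codiscard = cograph !
    }

  record Relation (X Y : Obj) : Set (o ⊔ ℓ) where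
    constructor relation
    field
      spn   : Span X Y
      jmono : JointlyMono (left spn) (right spn)
  open Relation public

  _≤ᵣ_ : ∀ {X Y} → Relation X Y → Relation X Y → Set (o ⊔ ℓ)
  r ≤ᵣ r' = Lift o (Σ[ a ∈ apex (spn r) ⇒ apex (spn r') ]
            ((left (spn r') ∘ a ≡ left (spn r)) × (right (spn r') ∘ a ≡ right (spn r))))

  image : ∀ {X Y} → Span X Y → Relation X Y
  image {X} {Y} s = relation (span Im (π₁ ∘ m) (π₂ ∘ m)) jm
    where
      open Factorisation (factorise ⟨ left s , right s ⟩)
      module P = IsProduct (product {X} {Y})
      step : ∀ {Z} (h : Z ⇒ Im) → m ∘ h ≡ ⟨ (π₁ ∘ m) ∘ h , (π₂ ∘ m) ∘ h ⟩
      step h = P.unique (m ∘ h) (sym assoc) (sym assoc)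
      jm : JointlyMono (π₁ ∘ m) (π₂ ∘ m)
      jm h k e₁ e₂ = m-mono h k
        (trans (step h) (trans (cong₂' e₁ e₂) (sym (step k))))
        where
          cong₂' : ∀ {Z} {a a' : Z ⇒ X} {b b' : Z ⇒ Y} → a ≡ a' → b ≡ b' →
                   ⟨ a , b ⟩ ≡ ⟨ a' , b' ⟩
          cong₂' refl refl = refl

  graphRel : ∀ {X Y} → X ⇒ Y → Relation X Y
  graphRel f = relation (graph f) (λ h k e₁ _ →
    trans (sym identityˡ) (trans e₁ identityˡ))

  cographRel : ∀ {X Y} → X ⇒ Y → Relation Y X
  cographRel f = relation (cograph f) (λ h k _ e₂ →
    trans (sym identityˡ) (trans e₂ identityˡ))

  Rel : CartesianBicategoryData (o ⊔ ℓ)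
  Rel = record
    { Hom = Relation
    ; _≤_ = _≤ᵣ_
    ; idₕ = graphRel id
    ; _⨾_ = λ r r' → image (spn r ⨾ₛ spn r')
    ; _⊗_ = λ r r' → image (spn r ⊗ₛ spn r')
    ; σ = graphRel swap
    ; α = graphRel assocʳ
    ; λₕ = graphRel unitorˡ
    ; ρₕ = graphRel unitorʳ
    ; copy = graphRel diag
    ; discard = graphRel !
    ; cocopy = cographRel diag
    ; codiscard = cographRel !
    }

module Submission where

-- A span is equivalent in Span^S to its image: the regular epi onto the image of its
-- tupling is a cover in both directions. Between jointly monic spans the S-order agrees
-- with the order of Rel, because a comparison map defined only after a cover descends
-- along that cover, regular epis being orthogonal to (jointly) monic maps. So taking
-- images and including relations are mutually inverse monotone maps. They preserve
-- composition and tensor because these are monotone in Span^S, which uses that covers are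
-- stable under pullback and closed under composition.

open import Defs
open import Level using (Level; _⊔_; lift)
open import Data.Product using (Σ-syntax; _×_; _,_)
open import Relation.Binary.PropositionalEquality
  using (_≡_; refl; sym; trans; cong; cong₂; subst; module ≡-Reasoning)

module MorphismReasoning {o ℓ : Level} (𝒞 : Category o ℓ) where
  open Category 𝒞
  open ≡-Reasoning

  module _ {A B C D : Obj} {f : C ⇒ D} {g : B ⇒ C} {h : A ⇒ B} where

    pullʳ : ∀ {i : A ⇒ C} → g ∘ h ≡ i → (f ∘ g) ∘ h ≡ f ∘ i
    pullʳ g∘h≡i = trans assoc (cong (f ∘_) g∘h≡i)

    pullˡ : ∀ {i : B ⇒ D} → f ∘ g ≡ i → f ∘ (g ∘ h) ≡ i ∘ h
    pullˡ f∘g≡i = trans (sym assoc) (cong (_∘ h) f∘g≡i)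

  glue-squares : ∀ {A B C D E Q} {f : B ⇒ E} {g : A ⇒ B} {f' : D ⇒ E} {g' : A ⇒ D}
                   {x : Q ⇒ A} {h : C ⇒ B} {c : Q ⇒ C} →
                 f ∘ g ≡ f' ∘ g' → g ∘ x ≡ h ∘ c → (f ∘ h) ∘ c ≡ f' ∘ (g' ∘ x)
  glue-squares {f = f} {g} {f'} {g'} {x} {h} {c} sq₁ sq₂ = begin
    (f ∘ h) ∘ c    ≡⟨ pullʳ (sym sq₂) ⟩
    f ∘ (g ∘ x)    ≡⟨ pullˡ sq₁ ⟩
    (f' ∘ g') ∘ x  ≡⟨ assoc ⟩
    f' ∘ (g' ∘ x)  ∎

module RegularEpiProperties {o ℓ : Level} (𝒞 : Category o ℓ) where
  open Category 𝒞
  open Notions 𝒞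
  open MorphismReasoning 𝒞
  open ≡-Reasoning

  regularEpi⇒epic : ∀ {A B} {e : A ⇒ B} → RegularEpi e →
                    ∀ {Z} (u v : B ⇒ Z) → u ∘ e ≡ v ∘ e → u ≡ v
  regularEpi⇒epic {e = e} (_ , f , g , coeq) u v u∘e≡v∘e =
    trans (unique {eq = v∘e-coequalises} u u∘e≡v∘e)
          (sym (unique {eq = v∘e-coequalises} v refl))
    where
      open IsCoequalizer coeq
      v∘e-coequalises : (v ∘ e) ∘ f ≡ (v ∘ e) ∘ g
      v∘e-coequalises = trans (pullʳ equality) (sym assoc)

  id-regularEpi : ∀ {A} → RegularEpi (id {A})
  id-regularEpi {A} = A , id , id , record
    { equality   = refl
    ; coequalize = λ h _ → h
    ; universal  = identityʳ
    ; unique     = λ u u∘id≡h → trans (sym identityʳ) u∘id≡h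
    }

  jointlyMono-fill : ∀ {A B C X Y} {q : A ⇒ B} {m₁ : C ⇒ X} {m₂ : C ⇒ Y}
                       {u : A ⇒ C} {v₁ : B ⇒ X} {v₂ : B ⇒ Y} →
                     RegularEpi q → JointlyMono m₁ m₂ →
                     m₁ ∘ u ≡ v₁ ∘ q → m₂ ∘ u ≡ v₂ ∘ q →
                     Σ[ d ∈ B ⇒ C ] (d ∘ q ≡ u) × (m₁ ∘ d ≡ v₁) × (m₂ ∘ d ≡ v₂)
  jointlyMono-fill {B = B} {C} {q = q} {u = u} q-reg@(_ , f , g , coeq) m-jointlyMono sq₁ sq₂ =
    d , universal , lower-triangle sq₁ , lower-triangle sq₂
    where
      open IsCoequalizer coeq

      m∘u-coequalises : ∀ {X} {m : C ⇒ X} {v} → m ∘ u ≡ v ∘ q → m ∘ (u ∘ f) ≡ m ∘ (u ∘ g)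
      m∘u-coequalises {m = m} {v} sq = begin
        m ∘ (u ∘ f)  ≡⟨ pullˡ sq ⟩
        (v ∘ q) ∘ f  ≡⟨ pullʳ equality ⟩
        v ∘ (q ∘ g)  ≡⟨ assoc ⟨
        (v ∘ q) ∘ g  ≡⟨ pullˡ sq ⟨
        m ∘ (u ∘ g)  ∎

      d : B ⇒ C
      d = coequalize u (m-jointlyMono (u ∘ f) (u ∘ g) (m∘u-coequalises sq₁) (m∘u-coequalises sq₂))

      lower-triangle : ∀ {X} {m : C ⇒ X} {v} → m ∘ u ≡ v ∘ q → m ∘ d ≡ v
      lower-triangle {m = m} {v} sq = regularEpi⇒epic q-reg (m ∘ d) v (trans (pullʳ universal) sq)

  mono-fill : ∀ {A B C D} {q : A ⇒ B} {m : C ⇒ D} {u : A ⇒ C} {v : B ⇒ D} →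
              RegularEpi q → Mono m → m ∘ u ≡ v ∘ q →
              Σ[ d ∈ B ⇒ C ] (d ∘ q ≡ u) × (m ∘ d ≡ v)
  mono-fill q-reg m-mono sq =
    let d , upper , lower , _ = jointlyMono-fill q-reg (λ h k eq _ → m-mono h k eq) sq sq
    in d , upper , lower

  iso∘regularEpi : ∀ {A B C} {e : A ⇒ B} {m : B ⇒ C} (m⁻¹ : C ⇒ B) →
                   m ∘ m⁻¹ ≡ id → m⁻¹ ∘ m ≡ id → RegularEpi e → RegularEpi (m ∘ e)
  iso∘regularEpi {m = m} m⁻¹ m∘m⁻¹≡id m⁻¹∘m≡id (X , f , g , coeq) = X , f , g , record
    { equality   = trans (pullʳ equality) (sym assoc)
    ; coequalize = λ h eq → coequalize h eq ∘ m⁻¹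
    ; universal  = trans (pullʳ (trans (pullˡ m⁻¹∘m≡id) identityˡ)) universal
    ; unique     = λ {_} {h} {eq} w w∘m∘e≡h → begin
        w                          ≡⟨ identityʳ ⟨
        w ∘ id                     ≡⟨ cong (w ∘_) m∘m⁻¹≡id ⟨
        w ∘ (m ∘ m⁻¹)              ≡⟨ assoc ⟨
        (w ∘ m) ∘ m⁻¹              ≡⟨ cong (_∘ m⁻¹) (unique (w ∘ m) (trans assoc w∘m∘e≡h)) ⟩
        coequalize h eq ∘ m⁻¹      ∎
    }
    where open IsCoequalizer coeq

  -- The mono part m of g ∘ f is orthogonal to the regular epis f and g; the two diagonal
  -- fillers make m split epi, hence an isomorphism.
  ∘-regularEpi : ∀ {A B C} {f : A ⇒ B} {g : B ⇒ C} → Factorisation (g ∘ f) →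
                 RegularEpi f → RegularEpi g → RegularEpi (g ∘ f)
  ∘-regularEpi fact f-reg g-reg =
    let d , _ , m∘d≡g = mono-fill f-reg m-mono factors
        m⁻¹ , _ , m∘m⁻¹≡id = mono-fill g-reg m-mono (trans m∘d≡g (sym identityˡ))
        m⁻¹∘m≡id = m-mono (m⁻¹ ∘ m) id
                     (trans (pullˡ m∘m⁻¹≡id) (trans identityˡ (sym identityʳ)))
    in subst RegularEpi factors (iso∘regularEpi m⁻¹ m∘m⁻¹≡id m⁻¹∘m≡id e-regEpi)
    where open Factorisation fact

module RelationsAsSpans {o ℓ : Level} (R : RegularCategory o ℓ) where
  open RegularCategory R
  open Category cat
  open Notions cat
  open Structures R
  open MorphismReasoning cat
  open RegularEpiProperties cat
  open ≡-Reasoning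
  module ×ₒ {A B} = IsProduct (product {A} {B})

  ⟨⟩∘ : ∀ {A B C D} {f : B ⇒ C} {g : B ⇒ D} {h : A ⇒ B} →
        ⟨ f , g ⟩ ∘ h ≡ ⟨ f ∘ h , g ∘ h ⟩
  ⟨⟩∘ = ×ₒ.unique _ (pullˡ ×ₒ.β₁) (pullˡ ×ₒ.β₂)

  ⁂∘⟨⟩ : ∀ {A B C D Z} {f : A ⇒ B} {g : C ⇒ D} {h : Z ⇒ A} {k : Z ⇒ C} →
         (f ⁂ g) ∘ ⟨ h , k ⟩ ≡ ⟨ f ∘ h , g ∘ k ⟩
  ⁂∘⟨⟩ = trans ⟨⟩∘ (cong₂ ⟨_,_⟩ (pullʳ ×ₒ.β₁) (pullʳ ×ₒ.β₂))

  record CoveredLift {P I A : Obj} (q : P ⇒ I) (e : A ⇒ I) : Set (o ⊔ ℓ) where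
    field
      Q                : Obj
      cover            : Q ⇒ P
      cover-regularEpi : RegularEpi cover
      lifting          : Q ⇒ A
      commutes         : e ∘ lifting ≡ q ∘ cover

  coveredLift : ∀ {P I A} (q : P ⇒ I) {e : A ⇒ I} → RegularEpi e → CoveredLift q e
  coveredLift q {e} e-reg = record
    { Q                = P
    ; cover            = p₂
    ; cover-regularEpi = regEpi-stable isPullback e-reg
    ; lifting          = p₁
    ; commutes         = IsPullback.commute isPullback
    }
    where open Pullback (pullback e q)

  record CoveredLift₂ {P I₁ I₂ A₁ A₂ : Obj} (q₁ : P ⇒ I₁) (q₂ : P ⇒ I₂)
                      (e₁ : A₁ ⇒ I₁) (e₂ : A₂ ⇒ I₂) : Set (o ⊔ ℓ) where
    field
      Q                : Obj
      cover            : Q ⇒ P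
      cover-regularEpi : RegularEpi cover
      lifting₁         : Q ⇒ A₁
      lifting₂         : Q ⇒ A₂
      commutes₁        : e₁ ∘ lifting₁ ≡ q₁ ∘ cover
      commutes₂        : e₂ ∘ lifting₂ ≡ q₂ ∘ cover

  coveredLift₂ : ∀ {P I₁ I₂ A₁ A₂} (q₁ : P ⇒ I₁) (q₂ : P ⇒ I₂) {e₁ : A₁ ⇒ I₁} {e₂ : A₂ ⇒ I₂} →
                 RegularEpi e₁ → RegularEpi e₂ → CoveredLift₂ q₁ q₂ e₁ e₂
  coveredLift₂ q₁ q₂ e₁-reg e₂-reg = record
    { Q                = L₂.Q
    ; cover            = L₁.cover ∘ L₂.cover
    ; cover-regularEpi = ∘-regularEpi (factorise _) L₂.cover-regularEpi L₁.cover-regularEpi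
    ; lifting₁         = L₁.lifting ∘ L₂.cover
    ; lifting₂         = L₂.lifting
    ; commutes₁        = trans (pullˡ L₁.commutes) assoc
    ; commutes₂        = trans L₂.commutes assoc
    }
    where
      module L₁ = CoveredLift (coveredLift q₁ e₁-reg)
      module L₂ = CoveredLift (coveredLift (q₂ ∘ L₁.cover) e₂-reg)

  infix 4 _≤ˢ_
  _≤ˢ_ : ∀ {X Y} → Span X Y → Span X Y → Set (o ⊔ ℓ)
  s ≤ˢ t = s ≤[ RegularEpi ] t

  ≤ˢ-trans : ∀ {X Y} {s t u : Span X Y} → s ≤ˢ t → t ≤ˢ u → s ≤ˢ u
  ≤ˢ-trans {s = s} {t} {u} (_ , π , a , π-reg , l₁ , r₁) (_ , π' , a' , π'-reg , l₂ , r₂) =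
    Q , π ∘ cover , a' ∘ lifting , ∘-regularEpi (factorise _) cover-regularEpi π-reg ,
    leg l₁ l₂ , leg r₁ r₂
    where
      open CoveredLift (coveredLift a π'-reg)
      leg : ∀ {W} {f : apex s ⇒ W} {g : apex t ⇒ W} {h : apex u ⇒ W} →
            f ∘ π ≡ g ∘ a → g ∘ π' ≡ h ∘ a' → f ∘ (π ∘ cover) ≡ h ∘ (a' ∘ lifting)
      leg sq₁ sq₂ = trans (pullˡ sq₁) (glue-squares sq₂ commutes)

  module Image {X Y} (s : Span X Y) = Factorisation (factorise ⟨ left s , right s ⟩)

  image-left : ∀ {X Y} (s : Span X Y) → left (spn (image s)) ∘ Image.e s ≡ left s
  image-left s = trans (pullʳ (Image.factors s)) ×ₒ.β₁

  image-right : ∀ {X Y} (s : Span X Y) → right (spn (image s)) ∘ Image.e s ≡ right s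
  image-right s = trans (pullʳ (Image.factors s)) ×ₒ.β₂

  spn-image-≤ˢ : ∀ {X Y} (s : Span X Y) → spn (image s) ≤ˢ s
  spn-image-≤ˢ s = apex s , Image.e s , id , Image.e-regEpi s ,
    trans (image-left s) (sym identityʳ) , trans (image-right s) (sym identityʳ)

  ≤ˢ-spn-image : ∀ {X Y} (s : Span X Y) → s ≤ˢ spn (image s)
  ≤ˢ-spn-image s = apex s , id , Image.e s , id-regularEpi ,
    trans identityʳ (sym (image-left s)) , trans identityʳ (sym (image-right s))

  ≤ˢ⇒≤ᵣ : ∀ {X Y} (r r' : Relation X Y) → spn r ≤ˢ spn r' → r ≤ᵣ r'
  ≤ˢ⇒≤ᵣ _ r' (_ , π , a , π-reg , l , r) =
    let d , _ , left-d , right-d = jointlyMono-fill π-reg (jmono r') (sym l) (sym r)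
    in lift (d , left-d , right-d)

  ≤ᵣ⇒≤ˢ : ∀ {X Y} {r r' : Relation X Y} → r ≤ᵣ r' → spn r ≤ˢ spn r'
  ≤ᵣ⇒≤ˢ {r = r} (lift (a , l , r')) =
    apex (spn r) , id , a , id-regularEpi , trans identityʳ (sym l) , trans identityʳ (sym r')

  image-monotone : ∀ {X Y} {s t : Span X Y} → s ≤ˢ t → image s ≤ᵣ image t
  image-monotone {s = s} {t} s≤t =
    ≤ˢ⇒≤ᵣ (image s) (image t) (≤ˢ-trans (spn-image-≤ˢ s) (≤ˢ-trans s≤t (≤ˢ-spn-image t)))

  image-spn : ∀ {X Y} (r : Relation X Y) → (image (spn r) ≤ᵣ r) × (r ≤ᵣ image (spn r))
  image-spn r = ≤ˢ⇒≤ᵣ (image (spn r)) r (spn-image-≤ˢ (spn r))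
              , ≤ˢ⇒≤ᵣ r (image (spn r)) (≤ˢ-spn-image (spn r))

  ⨾ₛ-monotone : ∀ {X Y Z} {s s' : Span X Y} {t t' : Span Y Z} →
                s ≤ˢ s' → t ≤ˢ t' → (s ⨾ₛ t) ≤ˢ (s' ⨾ₛ t')
  ⨾ₛ-monotone {s = s} {s'} {t} {t'} (_ , π , a , π-reg , l₁ , r₁) (_ , ρ , b , ρ-reg , l₂ , r₂) =
    Q , cover , u , cover-regularEpi , left-leg , right-leg
    where
      module P  = Pullback (pullback (right s) (left t))
      module P' = Pullback (pullback (right s') (left t'))
      open CoveredLift₂ (coveredLift₂ P.p₁ P.p₂ π-reg ρ-reg)

      lifts-commute : right s' ∘ (a ∘ lifting₁) ≡ left t' ∘ (b ∘ lifting₂)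
      lifts-commute = begin
        right s' ∘ (a ∘ lifting₁)  ≡⟨ glue-squares r₁ commutes₁ ⟨
        (right s ∘ P.p₁) ∘ cover   ≡⟨ cong (_∘ cover) (IsPullback.commute P.isPullback) ⟩
        (left t ∘ P.p₂) ∘ cover    ≡⟨ glue-squares l₂ commutes₂ ⟩
        left t' ∘ (b ∘ lifting₂)   ∎

      u : Q ⇒ P'.P
      u = IsPullback.universal P'.isPullback _ _ lifts-commute

      left-leg : (left s ∘ P.p₁) ∘ cover ≡ (left s' ∘ P'.p₁) ∘ u
      left-leg = trans (glue-squares l₁ commutes₁) (sym (pullʳ (IsPullback.β₁ P'.isPullback)))

      right-leg : (right t ∘ P.p₂) ∘ cover ≡ (right t' ∘ P'.p₂) ∘ u
      right-leg = trans (glue-squares r₂ commutes₂) (sym (pullʳ (IsPullback.β₂ P'.isPullback)))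

  ⊗ₛ-monotone : ∀ {X Y X' Y'} {s s' : Span X Y} {t t' : Span X' Y'} →
                s ≤ˢ s' → t ≤ˢ t' → (s ⊗ₛ t) ≤ˢ (s' ⊗ₛ t')
  ⊗ₛ-monotone {s = s} {s'} {t} {t'} (_ , π , a , π-reg , l₁ , r₁) (_ , ρ , b , ρ-reg , l₂ , r₂) =
    Q , cover , ⟨ a ∘ lifting₁ , b ∘ lifting₂ ⟩ , cover-regularEpi , leg l₁ l₂ , leg r₁ r₂
    where
      open CoveredLift₂ (coveredLift₂ π₁ π₂ π-reg ρ-reg)
      leg : ∀ {W W'} {f : apex s ⇒ W} {f' : apex s' ⇒ W} {g : apex t ⇒ W'} {g' : apex t' ⇒ W'} →
            f ∘ π ≡ f' ∘ a → g ∘ ρ ≡ g' ∘ b →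
            (f ⁂ g) ∘ cover ≡ (f' ⁂ g') ∘ ⟨ a ∘ lifting₁ , b ∘ lifting₂ ⟩
      leg {f = f} {f'} {g} {g'} sq₁ sq₂ = begin
        (f ⁂ g) ∘ cover                                ≡⟨ ⟨⟩∘ ⟩
        ⟨ (f ∘ π₁) ∘ cover , (g ∘ π₂) ∘ cover ⟩        ≡⟨ cong₂ ⟨_,_⟩ (glue-squares sq₁ commutes₁)
                                                                      (glue-squares sq₂ commutes₂) ⟩
        ⟨ f' ∘ (a ∘ lifting₁) , g' ∘ (b ∘ lifting₂) ⟩  ≡⟨ ⁂∘⟨⟩ ⟨
        (f' ⁂ g') ∘ ⟨ a ∘ lifting₁ , b ∘ lifting₂ ⟩    ∎

lemma8p3 : ∀ {o ℓ : Level} (R : RegularCategory o ℓ) →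
    let open Structures R
        open Notions (RegularCategory.cat R)
    in CBIso (SpanS RegularEpi) Rel
lemma8p3 R = record
  { F           = image
  ; G           = spn
  ; F-monotone  = image-monotone
  ; G-monotone  = λ {_} {_} {r} {r'} → ≤ᵣ⇒≤ˢ {r = r} {r'}
  ; GF≃id       = λ s → spn-image-≤ˢ s , ≤ˢ-spn-image s
  ; FG≃id       = image-spn
  ; F-id        = image-spn (graphRel id)
  ; F-⨾         = λ s t → image-monotone (⨾ₛ-monotone (≤ˢ-spn-image s) (≤ˢ-spn-image t))
                        , image-monotone (⨾ₛ-monotone (spn-image-≤ˢ s) (spn-image-≤ˢ t))
  ; F-⊗         = λ s t → image-monotone (⊗ₛ-monotone (≤ˢ-spn-image s) (≤ˢ-spn-image t))
                        , image-monotone (⊗ₛ-monotone (spn-image-≤ˢ s) (spn-image-≤ˢ t))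
  ; F-σ         = image-spn (graphRel swap)
  ; F-α         = image-spn (graphRel assocʳ)
  ; F-λ         = image-spn (graphRel unitorˡ)
  ; F-ρ         = image-spn (graphRel unitorʳ)
  ; F-copy      = image-spn (graphRel diag)
  ; F-discard   = image-spn (graphRel !)
  ; F-cocopy    = image-spn (cographRel diag)
  ; F-codiscard = image-spn (cographRel !)
  }
  where
    open Category (RegularCategory.cat R) using (id)
    open Structures R
    open RelationsAsSpans R
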